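{- Let $S \in \mathcal{L}_-$ be such that $3 \notin S$, and let $s \in \mathrm{msg}(S)$ with $s > F(S)$. Then $S\setminus\{s\} \in \mathcal{L}_-$ if and only if $s-1 \in (\mathbb{N}\setminus S)\cup\mathrm{msg}(S)$ and $s+1,\ s+3 \in \mathrm{msg}(S)$.
   Context: $\mathbb{N}=\{0,1,2,\dots\}$. $\mathcal{L}_-$ denotes the set of all submonoids $S$ of $(\mathbb{N},+)$ with $S \neq \{0\}$ such that $s+t-3,\ s+t-1,\ s+t+1 \in S$ for all $s,t \in S\setminus\{0,1\}$. For a numerical monoid $S$ (a submonoid of $(\mathbb{N},+)$ with finite complement), $\mathrm{msg}(S)$ denotes its unique minimal set of generators, and $F(S)$, the Frobenius number, is the largest integer not belonging to $S$. -}

module Defs where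

open import Level using (0ℓ)
open import Data.Nat using (ℕ; _+_; _∸_; _≤_; _<_)
open import Data.Product using (Σ; ∃; _×_)
open import Relation.Nullary using (¬_)
open import Relation.Unary using (Pred)
open import Relation.Binary.PropositionalEquality using (_≡_; _≢_)

Subset : Set₁
Subset = Pred ℕ 0ℓ

IsSubmonoid : Subset → Set
IsSubmonoid S = S 0 × (∀ a b → S a → S b → S (a + b))

InLminus : Subset → Set
InLminus S =
  IsSubmonoid S
  × (∃ λ n → n ≢ 0 × S n)
  × (∀ s t → S s → S t → 2 ≤ s → 2 ≤ t →
       S (s + t ∸ 3) × S (s + t ∸ 1) × S (s + t + 1))

_minus_ : Subset → ℕ → Subset
(S minus x) n = S n × n ≢ x

-- f is the Frobenius number of S: the largest integer not in S
-- (its existence also says S has finite complement, i.e. S is numerical)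
IsFrobenius : Subset → ℕ → Set
IsFrobenius S f = ¬ S f × (∀ n → f < n → S n)

-- x ∈ msg(S): the minimal generators of a submonoid of ℕ are exactly
-- the nonzero elements that are not a sum of two nonzero elements.
InMsg : Subset → ℕ → Set
InMsg S x =
  S x × x ≢ 0
  × ¬ (Σ ℕ λ a → Σ ℕ λ b → S a × S b × a ≢ 0 × b ≢ 0 × a + b ≡ x)

{-# OPTIONS --safe #-}
module Submission where

open import Defs
open import Data.Nat using (ℕ; zero; suc; _+_; _∸_; _<_; _≤_; z≤n; s≤s)
open import Data.Nat.Properties
open import Data.Product using (Σ; _×_; _,_; proj₁; proj₂)
open import Data.Sum using (_⊎_; inj₁; inj₂)
open import Relation.Nullary using (¬_; contradiction)
open import Function.Bundles using (_⇔_; mk⇔)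
open import Relation.Binary.PropositionalEquality

-- Since 3 ∉ S, also 1 ∉ S, so every nonzero element of S is at least 2 and the
-- 𝓛₋ operations apply to all of S ∖ {0}. Removing a minimal generator s leaves a
-- monoid, and S ∖ {s} stays in 𝓛₋ iff s never arises as a + b − 3, a + b − 1 or
-- a + b + 1 with a, b ∈ S ∖ {0, s}, i.e. iff none of s + 3, s + 1, s − 1 is a sum
-- of two nonzero elements of S. A decomposition of s + 1 or s + 3 cannot use s
-- itself, as 1, 3 ∉ S. Above the Frobenius number, "not such a sum" means
-- "minimal generator", except that s − 1 may be the gap F.

IsDecomposable : Subset → ℕ → Set
IsDecomposable S x = Σ ℕ λ a → Σ ℕ λ b → S a × S b × a ≢ 0 × b ≢ 0 × a + b ≡ x

LminusClosed : Subset → Set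
LminusClosed S = ∀ s t → S s → S t → 2 ≤ s → 2 ≤ t →
  S (s + t ∸ 3) × S (s + t ∸ 1) × S (s + t + 1)

ClosedUnder≥2 : (ℕ → ℕ → ℕ) → Subset → Set
ClosedUnder≥2 _∙_ S = ∀ a b → S a → S b → 2 ≤ a → 2 ≤ b → S (a ∙ b)

private variable
  S : Subset
  a b k m n s x F : ℕ

∸≡⇒≡+ : k ≤ m → m ∸ k ≡ n → m ≡ n + k
∸≡⇒≡+ k≤m refl = sym (m∸n+n≡m k≤m)

≡+⇒∸≡ : m ≡ n + k → m ∸ k ≡ n
≡+⇒∸≡ {n = n} {k} refl = m+n∸n≡m n k

2≤⇒≢0 : 2 ≤ a → a ≢ 0
2≤⇒≢0 (s≤s _) ()

module _ (closed : LminusClosed S) where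

  closedUnder-∸3 : ClosedUnder≥2 (λ a b → a + b ∸ 3) S
  closedUnder-∸3 a b Sa Sb 2≤a 2≤b = proj₁ (closed a b Sa Sb 2≤a 2≤b)

  closedUnder-∸1 : ClosedUnder≥2 (λ a b → a + b ∸ 1) S
  closedUnder-∸1 a b Sa Sb 2≤a 2≤b = proj₁ (proj₂ (closed a b Sa Sb 2≤a 2≤b))

  closedUnder-+1 : ClosedUnder≥2 (λ a b → a + b + 1) S
  closedUnder-+1 a b Sa Sb 2≤a 2≤b = proj₂ (proj₂ (closed a b Sa Sb 2≤a 2≤b))

¬S3⇒¬S1 : IsSubmonoid S → ¬ S 3 → ¬ S 1
¬S3⇒¬S1 (_ , +-closed) ¬S3 S1 = ¬S3 (+-closed 1 2 S1 (+-closed 1 1 S1 S1))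

¬S1⇒2≤ : ¬ S 1 → S a → a ≢ 0 → 2 ≤ a
¬S1⇒2≤ {a = zero}        _   _  a≢0 = contradiction refl a≢0
¬S1⇒2≤ {a = suc zero}    ¬S1 S1 _   = contradiction S1 ¬S1
¬S1⇒2≤ {a = suc (suc _)} _   _  _   = s≤s (s≤s z≤n)

∉⊎msg⇒¬decomposable : IsSubmonoid S → ¬ S x ⊎ InMsg S x → ¬ IsDecomposable S x
∉⊎msg⇒¬decomposable (_ , +-closed) (inj₁ ¬Sx) (a , b , Sa , Sb , _ , _ , refl) =
  ¬Sx (+-closed a b Sa Sb)
∉⊎msg⇒¬decomposable _ (inj₂ (_ , _ , ¬dec)) = ¬dec

minus-msg-isSubmonoid : IsSubmonoid S → InMsg S x → IsSubmonoid (S minus x)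
minus-msg-isSubmonoid {S} {x} (S0 , +-closed) (_ , x≢0 , ¬dec) =
  (S0 , λ 0≡x → x≢0 (sym 0≡x)) , minus-closed
  where
  minus-closed : ∀ a b → (S minus x) a → (S minus x) b → (S minus x) (a + b)
  minus-closed zero b _ Tb = Tb
  minus-closed a@(suc _) zero Ta _ = subst (S minus x) (sym (+-identityʳ a)) Ta
  minus-closed a@(suc _) b@(suc _) (Sa , _) (Sb , _) =
    +-closed a b Sa Sb , λ a+b≡x → ¬dec (a , b , Sa , Sb , (λ ()) , (λ ()) , a+b≡x)

aboveFrobenius-msg : IsFrobenius S F → F < x → ¬ IsDecomposable S x → InMsg S x
aboveFrobenius-msg {F = F} (_ , aboveF) F<x ¬dec =
  aboveF _ F<x , (λ x≡0 → n≮0 (subst (F <_) x≡0 F<x)) , ¬dec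

Frobenius≤⇒∉⊎msg : IsFrobenius S F → F ≤ x → ¬ IsDecomposable S x → ¬ S x ⊎ InMsg S x
Frobenius≤⇒∉⊎msg frob F≤x ¬dec with m≤n⇒m<n∨m≡n F≤x
... | inj₁ F<x = inj₂ (aboveFrobenius-msg frob F<x ¬dec)
... | inj₂ refl = inj₁ (proj₁ frob)

decomposition-avoids : ¬ S k → S a → S b → a + b ≡ s + k → (S minus s) a × (S minus s) b
decomposition-avoids {S = S} {k = k} {a = a} {b = b} {s = s} ¬Sk Sa Sb a+b≡s+k = (Sa , a≢s) , (Sb , b≢s)
  where
  a≢s : a ≢ s
  a≢s refl = ¬Sk (subst S (+-cancelˡ-≡ a b k a+b≡s+k) Sb)
  b≢s : b ≢ s
  b≢s refl = ¬Sk (subst S (+-cancelˡ-≡ b a k (trans (+-comm b a) a+b≡s+k)) Sa)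

closedUnder-∸⇒¬decomposable : ¬ S 1 → ¬ S k →
  ClosedUnder≥2 (λ a b → a + b ∸ k) (S minus s) → ¬ IsDecomposable S (s + k)
closedUnder-∸⇒¬decomposable {S} ¬S1 ¬Sk closed (a , b , Sa , Sb , a≢0 , b≢0 , a+b≡s+k)
  with decomposition-avoids ¬Sk Sa Sb a+b≡s+k
... | Ta , Tb =
  proj₂ (closed a b Ta Tb (¬S1⇒2≤ {S} ¬S1 Sa a≢0) (¬S1⇒2≤ {S} ¬S1 Sb b≢0)) (≡+⇒∸≡ a+b≡s+k)

closedUnder-+1⇒¬decomposable-pred : ¬ S 1 → s ≢ 0 →
  ClosedUnder≥2 (λ a b → a + b + 1) (S minus s) → ¬ IsDecomposable S (s ∸ 1)
closedUnder-+1⇒¬decomposable-pred {s = zero} _ s≢0 _ _ = contradiction refl s≢0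
closedUnder-+1⇒¬decomposable-pred {S = S} {s = suc s} ¬S1 _ closed (a , b , Sa , Sb , a≢0 , b≢0 , a+b≡s) =
  proj₂ (closed a b (Sa , a≢1+s) (Sb , b≢1+s) (¬S1⇒2≤ {S} ¬S1 Sa a≢0) (¬S1⇒2≤ {S} ¬S1 Sb b≢0))
        (trans (+-comm (a + b) 1) (cong suc a+b≡s))
  where
  a≢1+s : a ≢ suc s
  a≢1+s = <⇒≢ (s≤s (subst (a ≤_) a+b≡s (m≤m+n a b)))
  b≢1+s : b ≢ suc s
  b≢1+s = <⇒≢ (s≤s (subst (b ≤_) a+b≡s (m≤n+m b a)))

minus-LminusClosed : LminusClosed S → ¬ IsDecomposable S (s ∸ 1) →
  ¬ IsDecomposable S (s + 1) → ¬ IsDecomposable S (s + 3) → LminusClosed (S minus s)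
minus-LminusClosed {S} closed ¬dec₋₁ ¬dec₁ ¬dec₃ a b (Sa , _) (Sb , _) 2≤a 2≤b
  with closed a b Sa Sb 2≤a 2≤b
... | S₋₃ , S₋₁ , S₊₁ =
  (S₋₃ , λ e → ¬dec₃ (sumOf (∸≡⇒≡+ 3≤a+b e))) ,
  (S₋₁ , λ e → ¬dec₁ (sumOf (∸≡⇒≡+ (≤-trans (s≤s z≤n) 3≤a+b) e))) ,
  (S₊₁ , λ e → ¬dec₋₁ (sumOf (sym (≡+⇒∸≡ (sym e)))))
  where
  3≤a+b : 3 ≤ a + b
  3≤a+b = ≤-trans (n≤1+n 3) (+-mono-≤ 2≤a 2≤b)
  sumOf : a + b ≡ x → IsDecomposable S x
  sumOf a+b≡x = a , b , Sa , Sb , 2≤⇒≢0 2≤a , 2≤⇒≢0 2≤b , a+b≡x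

corollary2p9 : (S : Subset) → InLminus S → ¬ S 3 →
    (F : ℕ) → IsFrobenius S F →
    (s : ℕ) → InMsg S s → F < s →
    (InLminus (S minus s)
      ⇔ ((¬ S (s ∸ 1) ⊎ InMsg S (s ∸ 1)) × InMsg S (s + 1) × InMsg S (s + 3)))
corollary2p9 S (monoid , _ , closed) ¬S3 F frob s s-msg@(_ , s≢0 , _) F<s =
  mk⇔ necessary sufficient
  where
  ¬S1 = ¬S3⇒¬S1 monoid ¬S3
  F<s+ : ∀ k → F < s + k
  F<s+ k = ≤-trans F<s (m≤m+n s k)

  necessary : InLminus (S minus s) →
    (¬ S (s ∸ 1) ⊎ InMsg S (s ∸ 1)) × InMsg S (s + 1) × InMsg S (s + 3)
  necessary (_ , _ , closed₋) =
    Frobenius≤⇒∉⊎msg frob (∸-monoˡ-≤ 1 F<s)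
      (closedUnder-+1⇒¬decomposable-pred ¬S1 s≢0 (closedUnder-+1 closed₋)) ,
    aboveFrobenius-msg frob (F<s+ 1) (closedUnder-∸⇒¬decomposable ¬S1 ¬S1 (closedUnder-∸1 closed₋)) ,
    aboveFrobenius-msg frob (F<s+ 3) (closedUnder-∸⇒¬decomposable ¬S1 ¬S3 (closedUnder-∸3 closed₋))

  sufficient : (¬ S (s ∸ 1) ⊎ InMsg S (s ∸ 1)) × InMsg S (s + 1) × InMsg S (s + 3) →
    InLminus (S minus s)
  sufficient (gap⊎msg , s+1-msg@(S[s+1] , s+1≢0 , ¬dec₁) , (_ , _ , ¬dec₃)) =
    minus-msg-isSubmonoid monoid s-msg ,
    (s + 1 , s+1≢0 , S[s+1] , λ s+1≡s → 1+n≢n (trans (+-comm 1 s) s+1≡s)) ,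
    minus-LminusClosed closed (∉⊎msg⇒¬decomposable monoid gap⊎msg) ¬dec₁ ¬dec₃
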